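{- Define $(h_{2,1}(n))_{n\in\mathbb{N}}$ by $h_{2,1}(n)=2$ for integers $n\le0$, $h_{2,1}(1)=1$, and $h_{2,1}(n)=h_{2,1}(n-h_{2,1}(n-1))+h_{2,1}(n-2)$ for $n>1$. Then $h_{2,1}(0)=2$, $h_{2,1}(1)=1$, $h_{2,1}(2)=h_{2,1}(3)=3$, and for all integers $n\ge2$, $$h_{2,1}(2n)=3n-2,\qquad h_{2,1}(2n+1)=2n.$$ -}

module Defs where

open import Data.Integer using (ℤ; +_; _+_; _-_; _≤_; _<_)
open import Data.Product using (_×_)
open import Relation.Binary.PropositionalEquality using (_≡_)

IsH21 : (ℤ → ℤ) → Set
IsH21 h =
  (∀ n → n ≤ + 0 → h n ≡ + 2) ×
  (h (+ 1) ≡ + 1) ×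
  (∀ n → + 1 < n → h n ≡ h (n - h (n - + 1)) + h (n - + 2))

{-# OPTIONS --safe #-}
-- Every solution is positive: if h(n-1) > 0 then n - h(n-1) < n, so strong induction gives
-- h(n) = h(n - h(n-1)) + h(n-2) > 0. Hence the recurrence only consults smaller arguments and
-- the solution is unique. The closed form is a solution: for even n = 2k ≥ 6 the recursive call
-- lands at n - h(n-1) = 2, for odd n = 2k+1 ≥ 7 at 3 - k ≤ 0, where h is 2.
module Submission where

open import Defs
open import Data.Integer using (ℤ; +_; -[1+_]; _+_; _-_; _*_; -_; _≤_; _<_)
open import Data.Integer.Base using (+≤+; -≤+; +<+)
open import Data.Integer.Properties
  using (pos-*; +-comm; +-identityʳ; +-mono-<; +-monoʳ-<; neg-mono-<; neg-≤-pos; <⇒≤; <-trans;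
         module ≤-Reasoning)
open import Data.Integer.Tactic.RingSolver using (solve-∀)
open import Data.Nat as ℕ using (ℕ; suc; z≤n; s≤s; parity; ⌊_/2⌋; ⌈_/2⌉)
import Data.Nat.Properties as ℕₚ
open import Data.Nat.Induction using (<-rec)
open import Data.Parity.Base as ℙ using (Parity; 0ℙ; 1ℙ)
open import Data.Parity.Properties using (+-homo-+; p+p≡0ℙ)
open import Data.Product using (_×_; _,_; ∃; ∃-syntax)
open import Data.Sum using (_⊎_; inj₁; inj₂)
open import Relation.Binary.PropositionalEquality
  using (_≡_; refl; sym; trans; cong; cong₂; subst; module ≡-Reasoning)

<-rec-above-1 : ∀ {ℓ} (P : ℤ → Set ℓ) →
  (∀ n → n ≤ + 1 → P n) →
  (∀ n → + 1 < n → (∀ m → m < n → P m) → P n) →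
  ∀ n → P n
<-rec-above-1 P base step -[1+ _ ] = base _ -≤+
<-rec-above-1 P base step (+ 0) = base _ (+≤+ z≤n)
<-rec-above-1 P base step (+ 1) = base _ (+≤+ (s≤s z≤n))
<-rec-above-1 P base step (+ suc (suc k)) =
  <-rec (λ k → P (+ suc (suc k)))
        (λ k ih → step _ (+<+ (s≤s (s≤s z≤n))) (below k ih)) k
  where
  below : ∀ k → (∀ {j} → j ℕ.< k → P (+ suc (suc j))) →
          ∀ m → m < + suc (suc k) → P m
  below k ih -[1+ _ ] _ = base _ -≤+
  below k ih (+ 0) _ = base _ (+≤+ z≤n)
  below k ih (+ 1) _ = base _ (+≤+ (s≤s z≤n))
  below k ih (+ suc (suc j)) (+<+ (s≤s (s≤s j<k))) = ih j<k

i-j<i : ∀ i {j} → + 0 < j → i - j < i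
i-j<i i {j} 0<j = begin-strict
  i + - j   <⟨ +-monoʳ-< i (neg-mono-< 0<j) ⟩
  i + + 0   ≡⟨ +-identityʳ i ⟩
  i         ∎
  where open ≤-Reasoning

IsH21⇒positive : ∀ {h} → IsH21 h → ∀ n → + 0 < h n
IsH21⇒positive {h} (h-nonpos , h-1 , h-rec) = <-rec-above-1 _ base step
  where
  base : ∀ n → n ≤ + 1 → + 0 < h n
  base -[1+ k ] _ = subst (+ 0 <_) (sym (h-nonpos -[1+ k ] -≤+)) (+<+ (s≤s z≤n))
  base (+ 0) _ = subst (+ 0 <_) (sym (h-nonpos (+ 0) (+≤+ z≤n))) (+<+ (s≤s z≤n))
  base (+ 1) _ = subst (+ 0 <_) (sym h-1) (+<+ (s≤s z≤n))
  base (+ suc (suc _)) (+≤+ (s≤s ()))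

  step : ∀ n → + 1 < n → (∀ m → m < n → + 0 < h m) → + 0 < h n
  step n 1<n ih =
    subst (+ 0 <_) (sym (h-rec n 1<n)) (+-mono-< (ih _ jump<n) (ih _ (i-j<i n (+<+ (s≤s z≤n)))))
    where
    jump<n : n - h (n - + 1) < n
    jump<n = i-j<i n (ih _ (i-j<i n (+<+ (s≤s z≤n))))

IsH21-unique : ∀ {h h′} → IsH21 h → IsH21 h′ → ∀ n → h n ≡ h′ n
IsH21-unique {h} {h′} H@(h-nonpos , h-1 , h-rec) (h′-nonpos , h′-1 , h′-rec) =
  <-rec-above-1 _ base step
  where
  base : ∀ n → n ≤ + 1 → h n ≡ h′ n
  base -[1+ _ ] _ = trans (h-nonpos _ -≤+) (sym (h′-nonpos _ -≤+))
  base (+ 0) _ = trans (h-nonpos _ (+≤+ z≤n)) (sym (h′-nonpos _ (+≤+ z≤n)))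
  base (+ 1) _ = trans h-1 (sym h′-1)
  base (+ suc (suc _)) (+≤+ (s≤s ()))

  step : ∀ n → + 1 < n → (∀ m → m < n → h m ≡ h′ m) → h n ≡ h′ n
  step n 1<n ih = begin
    h n                                    ≡⟨ h-rec n 1<n ⟩
    h (n - h (n - + 1)) + h (n - + 2)      ≡⟨ cong₂ _+_ (ih _ (i-j<i n (IsH21⇒positive H _)))
                                                        (ih _ (i-j<i n (+<+ (s≤s z≤n)))) ⟩
    h′ (n - h (n - + 1)) + h′ (n - + 2)    ≡⟨ cong (λ x → h′ (n - x) + h′ (n - + 2))
                                                   (ih _ (i-j<i n (+<+ (s≤s z≤n)))) ⟩
    h′ (n - h′ (n - + 1)) + h′ (n - + 2)   ≡⟨ h′-rec n 1<n ⟨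
    h′ n                                   ∎
    where open ≡-Reasoning

Recurrence : (ℤ → ℤ) → ℤ → Set
Recurrence h n = h n ≡ h (n - h (n - + 1)) + h (n - + 2)

h₂₁[2k+p] : Parity → ℕ → ℤ
h₂₁[2k+p] 0ℙ 0 = + 2
h₂₁[2k+p] 0ℙ 1 = + 3
h₂₁[2k+p] 0ℙ k = + 3 * + k - + 2
h₂₁[2k+p] 1ℙ 0 = + 1
h₂₁[2k+p] 1ℙ 1 = + 3
h₂₁[2k+p] 1ℙ k = + 2 * + k

h₂₁ : ℤ → ℤ
h₂₁ (+ m)    = h₂₁[2k+p] (parity m) ⌊ m /2⌋
h₂₁ -[1+ _ ] = + 2

parity[k+k] : ∀ k → parity (k ℕ.+ k) ≡ 0ℙ
parity[k+k] k = trans (+-homo-+ k k) (p+p≡0ℙ (parity k))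

⌈k+k/2⌉≡k : ∀ k → ⌈ k ℕ.+ k /2⌉ ≡ k
⌈k+k/2⌉≡k k = ℕₚ.+-cancelˡ-≡ k _ _
  (trans (cong (ℕ._+ ⌈ k ℕ.+ k /2⌉) (ℕₚ.n≡⌊n+n/2⌋ k)) (ℕₚ.⌊n/2⌋+⌈n/2⌉≡n (k ℕ.+ k)))

parity[1+k+k] : ∀ k → parity (suc (k ℕ.+ k)) ≡ 1ℙ
parity[1+k+k] k = trans (+-homo-+ 1 (k ℕ.+ k)) (cong (1ℙ ℙ.+_) (parity[k+k] k))

+2*+k≡+[k+k] : ∀ k → + 2 * + k ≡ + (k ℕ.+ k)
+2*+k≡+[k+k] k = trans (sym (pos-* 2 k)) (cong (λ x → + (k ℕ.+ x)) (ℕₚ.+-identityʳ k))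

+2*+k++1≡+[1+k+k] : ∀ k → + 2 * + k + + 1 ≡ + suc (k ℕ.+ k)
+2*+k++1≡+[1+k+k] k = trans (+-comm (+ 2 * + k) (+ 1)) (cong (λ x → + 1 + x) (+2*+k≡+[k+k] k))

h₂₁[2k] : ∀ k → h₂₁ (+ 2 * + k) ≡ h₂₁[2k+p] 0ℙ k
h₂₁[2k] k = begin
  h₂₁ (+ 2 * + k)                              ≡⟨ cong h₂₁ (+2*+k≡+[k+k] k) ⟩
  h₂₁[2k+p] (parity (k ℕ.+ k)) ⌊ k ℕ.+ k /2⌋  ≡⟨ cong₂ h₂₁[2k+p] (parity[k+k] k) (sym (ℕₚ.n≡⌊n+n/2⌋ k)) ⟩
  h₂₁[2k+p] 0ℙ k                               ∎
  where open ≡-Reasoning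

h₂₁[2k+1] : ∀ k → h₂₁ (+ 2 * + k + + 1) ≡ h₂₁[2k+p] 1ℙ k
h₂₁[2k+1] k = begin
  h₂₁ (+ 2 * + k + + 1)                              ≡⟨ cong h₂₁ (+2*+k++1≡+[1+k+k] k) ⟩
  h₂₁[2k+p] (parity (suc (k ℕ.+ k))) ⌈ k ℕ.+ k /2⌉  ≡⟨ cong₂ h₂₁[2k+p] (parity[1+k+k] k) (⌈k+k/2⌉≡k k) ⟩
  h₂₁[2k+p] 1ℙ k                                     ∎
  where open ≡-Reasoning

h₂₁-even : ∀ n → + 2 ≤ n → h₂₁ (+ 2 * n) ≡ + 3 * n - + 2
h₂₁-even (+ suc (suc j)) _ = h₂₁[2k] (2 ℕ.+ j)
h₂₁-even (+ 0) (+≤+ ())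
h₂₁-even (+ 1) (+≤+ (s≤s ()))

h₂₁-odd : ∀ n → + 2 ≤ n → h₂₁ (+ 2 * n + + 1) ≡ + 2 * n
h₂₁-odd (+ suc (suc j)) _ = h₂₁[2k+1] (2 ℕ.+ j)
h₂₁-odd (+ 0) (+≤+ ())
h₂₁-odd (+ 1) (+≤+ (s≤s ()))

h₂₁-nonpos : ∀ n → n ≤ + 0 → h₂₁ n ≡ + 2
h₂₁-nonpos -[1+ _ ] _ = refl
h₂₁-nonpos (+ 0)    _ = refl
h₂₁-nonpos (+ suc _) (+≤+ ())

even-or-odd : ∀ n → + 0 ≤ n → ∃[ k ] (n ≡ + 2 * + k ⊎ n ≡ + 2 * + k + + 1)
even-or-odd (+ m) _ = go m
  where
  go : ∀ m → ∃[ k ] (+ m ≡ + 2 * + k ⊎ + m ≡ + 2 * + k + + 1)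
  go 0 = 0 , inj₁ refl
  go 1 = 0 , inj₂ refl
  go (suc (suc m)) with go m
  ... | k , inj₁ m≡2k   = suc k , inj₁ (trans (cong (λ x → + 2 + x) m≡2k) (shift (+ k)))
    where
    shift : ∀ x → + 2 + + 2 * x ≡ + 2 * (+ 1 + x)
    shift = solve-∀
  ... | k , inj₂ m≡2k+1 = suc k , inj₂ (trans (cong (λ x → + 2 + x) m≡2k+1) (shift (+ k)))
    where
    shift : ∀ x → + 2 + (+ 2 * x + + 1) ≡ + 2 * (+ 1 + x) + + 1
    shift = solve-∀

h₂₁-recurrence-even : ∀ j → Recurrence h₂₁ (+ 2 * + (3 ℕ.+ j))
h₂₁-recurrence-even j = begin
  h₂₁ n                                      ≡⟨ h₂₁[2k] (3 ℕ.+ j) ⟩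
  + 3 * + (3 ℕ.+ j) - + 2                    ≡⟨ split (+ j) ⟩
  + 3 + (+ 3 * + (2 ℕ.+ j) - + 2)            ≡⟨ cong₂ _+_ h[jump] h[n-2] ⟨
  h₂₁ (n - h₂₁ (n - + 1)) + h₂₁ (n - + 2)    ∎
  where
  open ≡-Reasoning
  n = + 2 * + (3 ℕ.+ j)
  split : ∀ x → + 3 * (+ 3 + x) - + 2 ≡ + 3 + (+ 3 * (+ 2 + x) - + 2)
  split = solve-∀
  n-1 : ∀ x → + 2 * (+ 3 + x) - + 1 ≡ + 2 * (+ 2 + x) + + 1
  n-1 = solve-∀
  n-2 : ∀ x → + 2 * (+ 3 + x) - + 2 ≡ + 2 * (+ 2 + x)
  n-2 = solve-∀
  gap : ∀ x → + 2 * (+ 3 + x) - + 2 * (+ 2 + x) ≡ + 2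
  gap = solve-∀
  h[n-1] : h₂₁ (n - + 1) ≡ + 2 * + (2 ℕ.+ j)
  h[n-1] = trans (cong h₂₁ (n-1 (+ j))) (h₂₁[2k+1] (2 ℕ.+ j))
  h[n-2] : h₂₁ (n - + 2) ≡ + 3 * + (2 ℕ.+ j) - + 2
  h[n-2] = trans (cong h₂₁ (n-2 (+ j))) (h₂₁[2k] (2 ℕ.+ j))
  h[jump] : h₂₁ (n - h₂₁ (n - + 1)) ≡ h₂₁ (+ 2)
  h[jump] = trans (cong (λ x → h₂₁ (n - x)) h[n-1]) (cong h₂₁ (gap (+ j)))

h₂₁-recurrence-odd : ∀ j → Recurrence h₂₁ (+ 2 * + (3 ℕ.+ j) + + 1)
h₂₁-recurrence-odd j = begin
  h₂₁ n                                      ≡⟨ h₂₁[2k+1] (3 ℕ.+ j) ⟩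
  + 2 * + (3 ℕ.+ j)                          ≡⟨ split (+ j) ⟩
  + 2 + + 2 * + (2 ℕ.+ j)                    ≡⟨ cong₂ _+_ h[jump] h[n-2] ⟨
  h₂₁ (n - h₂₁ (n - + 1)) + h₂₁ (n - + 2)    ∎
  where
  open ≡-Reasoning
  n = + 2 * + (3 ℕ.+ j) + + 1
  split : ∀ x → + 2 * (+ 3 + x) ≡ + 2 + + 2 * (+ 2 + x)
  split = solve-∀
  n-1 : ∀ x → + 2 * (+ 3 + x) + + 1 - + 1 ≡ + 2 * (+ 3 + x)
  n-1 = solve-∀
  n-2 : ∀ x → + 2 * (+ 3 + x) + + 1 - + 2 ≡ + 2 * (+ 2 + x) + + 1
  n-2 = solve-∀
  gap : ∀ x → + 2 * (+ 3 + x) + + 1 - (+ 3 * (+ 3 + x) - + 2) ≡ - x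
  gap = solve-∀
  h[n-1] : h₂₁ (n - + 1) ≡ + 3 * + (3 ℕ.+ j) - + 2
  h[n-1] = trans (cong h₂₁ (n-1 (+ j))) (h₂₁[2k] (3 ℕ.+ j))
  h[n-2] : h₂₁ (n - + 2) ≡ + 2 * + (2 ℕ.+ j)
  h[n-2] = trans (cong h₂₁ (n-2 (+ j))) (h₂₁[2k+1] (2 ℕ.+ j))
  h[jump] : h₂₁ (n - h₂₁ (n - + 1)) ≡ + 2
  h[jump] = begin
    h₂₁ (n - h₂₁ (n - + 1))                ≡⟨ cong (λ x → h₂₁ (n - x)) h[n-1] ⟩
    h₂₁ (n - (+ 3 * + (3 ℕ.+ j) - + 2))    ≡⟨ cong h₂₁ (gap (+ j)) ⟩
    h₂₁ (- + j)                            ≡⟨ h₂₁-nonpos (- + j) neg-≤-pos ⟩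
    + 2                                    ∎

h₂₁-recurrence : ∀ n → + 1 < n → Recurrence h₂₁ n
h₂₁-recurrence n 1<n with even-or-odd n (<⇒≤ (<-trans (+<+ (s≤s z≤n)) 1<n))
... | k , inj₁ refl = even k 1<n
  where
  even : ∀ k → + 1 < + 2 * + k → Recurrence h₂₁ (+ 2 * + k)
  even 0 (+<+ ())
  even 1 _ = refl
  even 2 _ = refl
  even (suc (suc (suc j))) _ = h₂₁-recurrence-even j
... | k , inj₂ refl = odd k 1<n
  where
  odd : ∀ k → + 1 < + 2 * + k + + 1 → Recurrence h₂₁ (+ 2 * + k + + 1)
  odd 0 (+<+ (s≤s ()))
  odd 1 _ = refl
  odd 2 _ = refl
  odd (suc (suc (suc j))) _ = h₂₁-recurrence-odd j

h₂₁-isH21 : IsH21 h₂₁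
h₂₁-isH21 = h₂₁-nonpos , refl , h₂₁-recurrence

theorem5p3 : (∃ λ h → IsH21 h) ×
    (∀ h → IsH21 h →
      (h (+ 0) ≡ + 2) × (h (+ 1) ≡ + 1) × (h (+ 2) ≡ + 3) × (h (+ 3) ≡ + 3) ×
      (∀ (n : ℤ) → + 2 ≤ n →
        (h (+ 2 * n) ≡ + 3 * n - + 2) × (h (+ 2 * n + + 1) ≡ + 2 * n)))
theorem5p3 = (h₂₁ , h₂₁-isH21) , λ h H →
  let h≡h₂₁ = IsH21-unique H h₂₁-isH21 in
  h≡h₂₁ (+ 0) , h≡h₂₁ (+ 1) , h≡h₂₁ (+ 2) , h≡h₂₁ (+ 3) ,
  λ n 2≤n → trans (h≡h₂₁ _) (h₂₁-even n 2≤n) , trans (h≡h₂₁ _) (h₂₁-odd n 2≤n)
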